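{- For every $n\ge 4$, the maximum cardinality $\gamma_P(n)$ of a minimal pair-complete subset of $S_n$ satisfies $\gamma_P(n)\ge\gamma_I(n)=\lfloor n^2/4\rfloor$, where $\gamma_I(n)$ is the maximum cardinality of a minimal inversion-complete subset of $S_n$.
   Context: $S_n$ is the set of permutations of $[n]$; $\pi$ covers the ordered pair $(\pi(k),\pi(l))$ iff $k<l$. An inversion is a pair $(j,i)$ with $1\le i<j\le n$. $Q\subseteq S_n$ is inversion-complete if every inversion is covered by some element of $Q$, and minimally inversion-complete if no proper subset is inversion-complete. $P\subseteq S_n$ is pair-complete if every ordered pair $(i,j)$ of distinct elements of $[n]$ is covered by some element of $P$, and minimally pair-complete if no proper subset of $P$ is pair-complete. -}

module Defs where

open import Data.Nat using (ℕ; _*_; _≤_; _≡ᵇ_)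
open import Data.Nat.DivMod using (_/_)
open import Data.Fin using (Fin) renaming (_<_ to _<ᶠ_)
open import Data.Vec using (Vec; lookup)
open import Data.List using (List; length)
open import Data.List.Membership.Propositional using (_∈_)
open import Data.List.Relation.Unary.All using (All)
open import Data.List.Relation.Unary.Unique.Propositional using (Unique)
open import Data.List.Relation.Binary.Subset.Propositional using (_⊆_)
open import Data.Product using (Σ; ∃; ∃-syntax; _×_)
open import Relation.Binary.PropositionalEquality using (_≡_; _≢_)
open import Relation.Nullary using (¬_)

-- A permutation π of [n] (with [n] realised as Fin n) is given in one-line
-- notation: the vector (π(0), …, π(n-1)), required to be injective
-- (hence bijective, since the domain and codomain are both Fin n).
IsPerm : ∀ {n} → Vec (Fin n) n → Set
IsPerm {n} π = ∀ (i j : Fin n) → lookup π i ≡ lookup π j → i ≡ j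

-- A subset of S_n: a duplicate-free list of permutations; its cardinality is its length.
IsSubsetOfS : ∀ n → List (Vec (Fin n) n) → Set
IsSubsetOfS n Q = All IsPerm Q × Unique Q

Covers : ∀ {n} → Vec (Fin n) n → Fin n → Fin n → Set
Covers {n} π a b = ∃[ k ] ∃[ l ] (k <ᶠ l × lookup π k ≡ a × lookup π l ≡ b)

InversionComplete : ∀ {n} → List (Vec (Fin n) n) → Set
InversionComplete {n} Q =
  ∀ (a b : Fin n) → b <ᶠ a → ∃[ π ] (π ∈ Q × Covers π a b)

PairComplete : ∀ {n} → List (Vec (Fin n) n) → Set
PairComplete {n} P =
  ∀ (a b : Fin n) → a ≢ b → ∃[ π ] (π ∈ P × Covers π a b)

_⊂_ : ∀ {n} → List (Vec (Fin n) n) → List (Vec (Fin n) n) → Set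
Q' ⊂ Q = Q' ⊆ Q × ¬ (Q ⊆ Q')

MinimallyInversionComplete : ∀ {n} → List (Vec (Fin n) n) → Set
MinimallyInversionComplete {n} Q =
  InversionComplete Q × (∀ (Q' : List (Vec (Fin n) n)) → Q' ⊂ Q → ¬ InversionComplete Q')

MinimallyPairComplete : ∀ {n} → List (Vec (Fin n) n) → Set
MinimallyPairComplete {n} P =
  PairComplete P × (∀ (P' : List (Vec (Fin n) n)) → P' ⊂ P → ¬ PairComplete P')

IsGammaI : ℕ → ℕ → Set
IsGammaI n m =
  (∃[ Q ] (IsSubsetOfS n Q × MinimallyInversionComplete Q × length Q ≡ m)) ×
  (∀ Q → IsSubsetOfS n Q → MinimallyInversionComplete Q → length Q ≤ m)

IsGammaP : ℕ → ℕ → Set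
IsGammaP n m =
  (∃[ P ] (IsSubsetOfS n P × MinimallyPairComplete P × length P ≡ m)) ×
  (∀ P → IsSubsetOfS n P → MinimallyPairComplete P → length P ≤ m)

-- A minimal inversion-complete family Q gives each of its permutations a private
-- inversion, covered by no other member of Q. These private inversions form a
-- triangle-free graph on [n]: if (b , a), (c , b) and (c , a) with a < b < c were all
-- private, the permutation owning (c , a) would also cover (b , a) or (c , b), wherever
-- it places b. Mantel's theorem then bounds |Q| by ⌊n²/4⌋. Conversely, split [n] into a
-- lower block A and an upper block B of sizes ⌊n/2⌋ and ⌈n/2⌉; the |A| |B| permutations
-- listing A ∖ {a}, b, a, B ∖ {b} cover every ordered pair, and the one indexed by (a , b)
-- is the only one covering (b , a). So they form a family of size ⌊n²/4⌋ that is
-- minimal both as an inversion-complete and as a pair-complete family.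
module Submission where

open import Defs
open import Data.Nat using (ℕ; zero; suc; _+_; _*_; _≤_; _<_; z≤n; s≤s; z<s)
import Data.Nat.Properties as ℕ
open import Data.Nat.DivMod using (_/_; _%_; m*n/n≡m; m*n%n≡0; +-distrib-/; /-monoˡ-≤)
open import Data.Nat.Tactic.RingSolver using (solve-∀)
open import Data.Fin as Fin using (Fin; toℕ; fromℕ<; _↑ˡ_; _↑ʳ_; splitAt; punchOut) renaming (_<_ to _<ᶠ_)
import Data.Fin.Properties as Fin
open import Data.Fin.Permutation using (Permutation′; transpose; _∘ₚ_; _⟨$⟩ʳ_; _⟨$⟩ˡ_; inverseˡ; inverseʳ)
import Data.Fin.Permutation.Components as PC
open import Data.Vec using (Vec; lookup; tabulate)
import Data.Vec.Properties as Vec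
open import Data.List using (List; []; _∷_; length; map; filter; _++_; cartesianProductWith; allFin)
import Data.List.Properties as List
open import Data.List.Membership.Propositional using (_∈_; _∉_; find; lose)
open import Data.List.Membership.Propositional.Properties using (∈-filter⁺; ∈-filter⁻; ∈-map⁻; ∈-allFin; ∈-cartesianProductWith⁺; ∈-cartesianProductWith⁻)
open import Data.List.Relation.Unary.Any as Any using (here; there; any?)
open import Data.List.Relation.Unary.All as All using (All; []; _∷_)
import Data.List.Relation.Unary.All.Properties as All
import Data.List.Relation.Unary.AllPairs as AllPairs
open import Data.List.Relation.Unary.Unique.Propositional using (Unique; []; _∷_)
import Data.List.Relation.Unary.Unique.Propositional.Properties as Unique
open import Data.List.Relation.Binary.Subset.Propositional using (_⊆_)
open import Data.Product using (∃-syntax; _×_; _,_; proj₁; proj₂; uncurry)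
open import Data.Sum as Sum using (_⊎_; inj₁; inj₂)
open import Data.Empty using (⊥; ⊥-elim)
open import Function using (_∘_; case_of_)
open import Relation.Binary.Definitions using (DecidableEquality; tri<; tri≈; tri>)
open import Relation.Binary.PropositionalEquality using (_≡_; _≢_; ≢-sym; refl; sym; trans; cong; cong₂; subst; subst₂; module ≡-Reasoning)
open import Relation.Nullary using (¬_; Dec; yes; no; ¬?)
open import Relation.Nullary.Decidable using (_×-dec_; _→-dec_; dec-true; dec-false)
open import Relation.Unary using (Decidable)

length-filter+length-filter-∁ : ∀ {A : Set} {P : A → Set} (P? : Decidable P) (xs : List A) →
  length (filter P? xs) + length (filter (¬? ∘ P?) xs) ≡ length xs
length-filter+length-filter-∁ P? [] = refl
length-filter+length-filter-∁ P? (x ∷ xs) with P? x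
... | yes _ = cong suc (length-filter+length-filter-∁ P? xs)
... | no _ = trans (ℕ.+-suc _ _) (cong suc (length-filter+length-filter-∁ P? xs))

module _ {A : Set} (_≟_ : DecidableEquality A) where

  ⊈⇒∃∉ : ∀ (xs ys : List A) → ¬ (xs ⊆ ys) → ∃[ x ] (x ∈ xs × x ∉ ys)
  ⊈⇒∃∉ [] ys xs⊈ys = ⊥-elim (xs⊈ys (λ ()))
  ⊈⇒∃∉ (x ∷ xs) ys x∷xs⊈ys with any? (x ≟_) ys
  ... | no x∉ys = x , here refl , x∉ys
  ... | yes x∈ys with ⊈⇒∃∉ xs ys (λ xs⊆ys → x∷xs⊈ys λ { (here refl) → x∈ys ; (there w) → xs⊆ys w })
  ...   | z , z∈xs , z∉ys = z , there z∈xs , z∉ys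

  Unique-⊆⇒length≤ : ∀ {xs ys : List A} → Unique xs → xs ⊆ ys → length xs ≤ length ys
  Unique-⊆⇒length≤ {[]} _ _ = z≤n
  Unique-⊆⇒length≤ {x ∷ xs} {ys} (x∉xs ∷ xs!) x∷xs⊆ys = ℕ.≤-trans
      (s≤s (Unique-⊆⇒length≤ xs! xs⊆ys-x))
      (List.filter-notAll (¬? ∘ (_≟ x)) ys (Any.map (λ { refl x≢x → x≢x refl }) (x∷xs⊆ys (here refl))))
    where
    xs⊆ys-x : xs ⊆ filter (¬? ∘ (_≟ x)) ys
    xs⊆ys-x w = ∈-filter⁺ (¬? ∘ (_≟ x)) (x∷xs⊆ys (there w)) (λ { refl → All.lookup x∉xs w refl })

Unique-map⁺ : ∀ {A B : Set} (f : A → B) {xs : List A} →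
  (∀ {x y} → x ∈ xs → y ∈ xs → f x ≡ f y → x ≡ y) → Unique xs → Unique (map f xs)
Unique-map⁺ f inj [] = []
Unique-map⁺ f inj (x∉xs ∷ xs!) =
  All.map⁺ (All.tabulate (λ y∈xs fx≡fy → All.lookup x∉xs y∈xs (inj (here refl) (there y∈xs) fx≡fy))) ∷
  Unique-map⁺ f (λ x∈ y∈ → inj (there x∈) (there y∈)) xs!

length-cartesianProductWith : ∀ {A B C : Set} (f : A → B → C) xs ys →
  length (cartesianProductWith f xs ys) ≡ length xs * length ys
length-cartesianProductWith f [] ys = refl
length-cartesianProductWith f (x ∷ xs) ys = begin
  length (map (f x) ys ++ cartesianProductWith f xs ys)     ≡⟨ List.length-++ (map (f x) ys) ⟩
  length (map (f x) ys) + length (cartesianProductWith f xs ys)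
    ≡⟨ cong₂ _+_ (List.length-map (f x) ys) (length-cartesianProductWith f xs ys) ⟩
  length ys + length xs * length ys                          ∎
  where open ≡-Reasoning

Perm : ℕ → Set
Perm n = Vec (Fin n) n

_≟ₚ_ : ∀ {n} → DecidableEquality (Perm n)
_≟ₚ_ = Vec.≡-dec Fin._≟_

Covers? : ∀ {n} (π : Perm n) (a b : Fin n) → Dec (Covers π a b)
Covers? π a b = Fin.any? λ k → Fin.any? λ l →
  (k Fin.<? l) ×-dec (lookup π k Fin.≟ a) ×-dec (lookup π l Fin.≟ b)

IsPerm⇒surjective : ∀ {n} (π : Perm n) → IsPerm π → ∀ b → ∃[ k ] (lookup π k ≡ b)
IsPerm⇒surjective {suc n} π π-inj b with Fin.any? (λ k → lookup π k Fin.≟ b)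
... | yes hit = hit
... | no miss = ⊥-elim (Fin.<⇒notInjective (ℕ.n<1+n n) squeezed-inj)
  where
  squeezed : Fin (suc n) → Fin n
  squeezed k = punchOut {i = b} λ b≡πk → miss (k , sym b≡πk)
  squeezed-inj : ∀ {k l} → squeezed k ≡ squeezed l → k ≡ l
  squeezed-inj {k} {l} eq =
    π-inj k l (Fin.punchOut-injective (λ e → miss (k , sym e)) (λ e → miss (l , sym e)) eq)

module _ {n} (i j : Fin n) where

  transpose-ˡ : PC.transpose i j i ≡ j
  transpose-ˡ rewrite dec-true (i Fin.≟ i) refl = refl

  transpose-ʳ : PC.transpose i j j ≡ i
  transpose-ʳ with j Fin.≟ i
  ... | yes j≡i = j≡i
  ... | no _ rewrite dec-true (j Fin.≟ j) refl = refl

  transpose-≢ : ∀ {k} → k ≢ i → k ≢ j → PC.transpose i j k ≡ k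
  transpose-≢ {k} k≢i k≢j rewrite dec-false (k Fin.≟ i) k≢i | dec-false (k Fin.≟ j) k≢j = refl

module _ {n} (ρ : Permutation′ n) where

  oneLine : Perm n
  oneLine = tabulate (ρ ⟨$⟩ʳ_)

  lookup-oneLine : ∀ k → lookup oneLine k ≡ ρ ⟨$⟩ʳ k
  lookup-oneLine = Vec.lookup∘tabulate (ρ ⟨$⟩ʳ_)

  position-oneLine : ∀ k → ρ ⟨$⟩ˡ lookup oneLine k ≡ k
  position-oneLine k = trans (cong (ρ ⟨$⟩ˡ_) (lookup-oneLine k)) (inverseˡ ρ)

  oneLine-IsPerm : IsPerm oneLine
  oneLine-IsPerm i j eq = trans (sym (position-oneLine i)) (trans (cong (ρ ⟨$⟩ˡ_) eq) (position-oneLine j))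

  oneLine-covers : ∀ {x y} → ρ ⟨$⟩ˡ x <ᶠ ρ ⟨$⟩ˡ y → Covers oneLine x y
  oneLine-covers x<y =
    _ , _ , x<y , trans (lookup-oneLine _) (inverseʳ ρ) , trans (lookup-oneLine _) (inverseʳ ρ)

  oneLine-covers⁻ : ∀ {x y} → Covers oneLine x y → ρ ⟨$⟩ˡ x <ᶠ ρ ⟨$⟩ˡ y
  oneLine-covers⁻ (k , l , k<l , refl , refl) =
    subst₂ _<ᶠ_ (sym (position-oneLine k)) (sym (position-oneLine l)) k<l

module _ {n} (R : Fin n → Fin n → Set) where

  Complete : List (Perm n) → Set
  Complete Q = ∀ a b → R a b → ∃[ π ] (π ∈ Q × Covers π a b)

  MinimallyComplete : List (Perm n) → Set
  MinimallyComplete Q = Complete Q × (∀ Q' → Q' ⊂ Q → ¬ Complete Q')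

  PrivatePair : List (Perm n) → Perm n → Fin n → Fin n → Set
  PrivatePair Q π a b = R a b × Covers π a b × All (λ π' → Covers π' a b → π' ≡ π) Q

  private⇒minimal : ∀ {Q} → Complete Q → (∀ {π} → π ∈ Q → ∃[ a ] ∃[ b ] PrivatePair Q π a b) →
    MinimallyComplete Q
  private⇒minimal {Q} complete private-pair = complete , λ Q' (Q'⊆Q , Q⊈Q') complete' →
    let π , π∈Q , π∉Q' = ⊈⇒∃∉ _≟ₚ_ Q Q' Q⊈Q'
        a , b , Rab , _ , only-π = private-pair π∈Q
        π' , π'∈Q' , π'-covers = complete' a b Rab
    in π∉Q' (subst (_∈ Q') (All.lookup only-π (Q'⊆Q π'∈Q') π'-covers) π'∈Q')

  module _ (R? : ∀ a b → Dec (R a b)) where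

    privatePair? : ∀ Q π → Dec (∃[ a ] ∃[ b ] PrivatePair Q π a b)
    privatePair? Q π = Fin.any? λ a → Fin.any? λ b →
      R? a b ×-dec Covers? π a b ×-dec All.all? (λ π' → Covers? π' a b →-dec (π' ≟ₚ π)) Q

    -- Without a private pair for π, the list Q with π removed would still be complete.
    minimal⇒private : ∀ {Q π} → MinimallyComplete Q → π ∈ Q → ∃[ a ] ∃[ b ] PrivatePair Q π a b
    minimal⇒private {Q} {π} (complete , minimal) π∈Q with privatePair? Q π
    ... | yes private-pair = private-pair
    ... | no no-private-pair = ⊥-elim (minimal Q-π (Q-π⊆Q , λ Q⊆Q-π → π∉Q-π (Q⊆Q-π π∈Q)) complete-Q-π)
      where
      Q-π : List (Perm n)
      Q-π = filter (¬? ∘ (_≟ₚ π)) Q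
      Q-π⊆Q : Q-π ⊆ Q
      Q-π⊆Q = proj₁ ∘ ∈-filter⁻ (¬? ∘ (_≟ₚ π)) {xs = Q}
      π∉Q-π : ¬ (π ∈ Q-π)
      π∉Q-π π∈ = proj₂ (∈-filter⁻ (¬? ∘ (_≟ₚ π)) {xs = Q} π∈) refl
      complete-Q-π : Complete Q-π
      complete-Q-π a b Rab with Any.any? (λ π' → Covers? π' a b) Q-π
      ... | yes covered = find covered
      ... | no uncovered = ⊥-elim (no-private-pair (a , b , Rab , π-covers , only-π))
        where
        only-π : All (λ π' → Covers π' a b → π' ≡ π) Q
        only-π = All.tabulate λ {π'} π'∈Q covers → case π' ≟ₚ π of λ
          { (yes π'≡π) → π'≡π
          ; (no π'≢π) → ⊥-elim (uncovered (lose (∈-filter⁺ (¬? ∘ (_≟ₚ π)) π'∈Q π'≢π) covers)) }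
        π-covers : Covers π a b
        π-covers with complete a b Rab
        ... | π' , π'∈Q , covers = subst (λ σ → Covers σ a b) (All.lookup only-π π'∈Q covers) covers

Inversion : ∀ {n} → Fin n → Fin n → Set
Inversion a b = b <ᶠ a

inversion? : ∀ {n} (a b : Fin n) → Dec (Inversion a b)
inversion? a b = b Fin.<? a

Edge : ℕ → Set
Edge n = Fin n × Fin n

module _ {n : ℕ} where

  -- An edge {a, b} with b < a is stored once, as the pair (a , b).
  Oriented : List (Edge n) → Set
  Oriented E = ∀ {a b} → (a , b) ∈ E → b <ᶠ a

  TriangleFree : List (Edge n) → Set
  TriangleFree E = ∀ {a b c} → (b , a) ∈ E → (c , b) ∈ E → (c , a) ∈ E → ⊥

  Spans : List (Fin n) → List (Edge n) → Set
  Spans V E = ∀ {a b} → (a , b) ∈ E → a ∈ V × b ∈ V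

  Adjacent : List (Edge n) → Fin n → Fin n → Set
  Adjacent E a b = (a , b) ∈ E ⊎ (b , a) ∈ E

  TriangleFree⇒¬triangle : ∀ {E} → Oriented E → TriangleFree E →
    ∀ {a b c} → Adjacent E a b → Adjacent E b c → Adjacent E a c → ⊥
  TriangleFree⇒¬triangle o t (inj₁ ab) (inj₁ bc) (inj₁ ac) = t bc ab ac
  TriangleFree⇒¬triangle o t (inj₁ ab) (inj₁ bc) (inj₂ ca) = ℕ.<-asym (o ca) (ℕ.<-trans (o bc) (o ab))
  TriangleFree⇒¬triangle o t (inj₁ ab) (inj₂ cb) (inj₁ ac) = t cb ac ab
  TriangleFree⇒¬triangle o t (inj₁ ab) (inj₂ cb) (inj₂ ca) = t ab ca cb
  TriangleFree⇒¬triangle o t (inj₂ ba) (inj₁ bc) (inj₁ ac) = t ac ba bc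
  TriangleFree⇒¬triangle o t (inj₂ ba) (inj₁ bc) (inj₂ ca) = t ca bc ba
  TriangleFree⇒¬triangle o t (inj₂ ba) (inj₂ cb) (inj₁ ac) = ℕ.<-asym (o ac) (ℕ.<-trans (o ba) (o cb))
  TriangleFree⇒¬triangle o t (inj₂ ba) (inj₂ cb) (inj₂ ca) = t ba cb ca

  -- Deleting the edge uv together with u and v: every other edge at u or v has a far
  -- endpoint w ∉ {u, v}, and no w is reached from both u and v, as uvw would be a triangle.
  module WithoutEdge
    (V : List (Fin n)) (u v : Fin n) (E : List (Edge n)) (V! : Unique V) (uv∷E! : Unique ((u , v) ∷ E))
    (oriented : Oriented ((u , v) ∷ E)) (triangle-free : TriangleFree ((u , v) ∷ E))
    (spans : Spans V ((u , v) ∷ E)) where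

    Endpoint : Fin n → Set
    Endpoint c = c ≡ u ⊎ c ≡ v

    Away : Fin n → Set
    Away w = w ≢ u × w ≢ v

    endpoint-or-away : ∀ w → Endpoint w ⊎ Away w
    endpoint-or-away w with w Fin.≟ u | w Fin.≟ v
    ... | yes w≡u | _ = inj₁ (inj₁ w≡u)
    ... | no _ | yes w≡v = inj₁ (inj₂ w≡v)
    ... | no w≢u | no w≢v = inj₂ (w≢u , w≢v)

    away? : Decidable Away
    away? w = ¬? (w Fin.≟ u) ×-dec ¬? (w Fin.≟ v)

    Inner : Edge n → Set
    Inner (a , b) = Away a × Away b

    inner? : Decidable Inner
    inner? (a , b) = away? a ×-dec away? b

    V' : List (Fin n)
    V' = filter away? V

    E' : List (Edge n)
    E' = filter inner? E

    R : List (Edge n)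
    R = filter (¬? ∘ inner?) E

    v<u : v <ᶠ u
    v<u = oriented (here refl)

    ∈V'⇒away : ∀ {w} → w ∈ V' → Away w
    ∈V'⇒away = proj₂ ∘ ∈-filter⁻ away? {xs = V}

    2+|V'|≤|V| : 2 + length V' ≤ length V
    2+|V'|≤|V| = Unique-⊆⇒length≤ Fin._≟_ u∷v∷V'! u∷v∷V'⊆V
      where
      u∷v∷V'! : Unique (u ∷ v ∷ V')
      u∷v∷V'! = ((λ u≡v → ℕ.<-irrefl (cong Fin.toℕ (sym u≡v)) v<u)
                  ∷ All.tabulate (λ w∈V' u≡w → proj₁ (∈V'⇒away w∈V') (sym u≡w)))
              ∷ All.tabulate (λ w∈V' v≡w → proj₂ (∈V'⇒away w∈V') (sym v≡w))
              ∷ Unique.filter⁺ away? V!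
      u∷v∷V'⊆V : u ∷ v ∷ V' ⊆ V
      u∷v∷V'⊆V (here refl) = proj₁ (spans (here refl))
      u∷v∷V'⊆V (there (here refl)) = proj₂ (spans (here refl))
      u∷v∷V'⊆V (there (there w∈V')) = proj₁ (∈-filter⁻ away? {xs = V} w∈V')

    E! : Unique E
    E! = AllPairs.tail uv∷E!

    E'! : Unique E'
    E'! = Unique.filter⁺ inner? E!

    E'⊆E : E' ⊆ E
    E'⊆E = proj₁ ∘ ∈-filter⁻ inner? {xs = E}

    E'-spans : Spans V' E'
    E'-spans ab∈E' with ∈-filter⁻ inner? ab∈E'
    ... | ab∈E , a-away , b-away =
      ∈-filter⁺ away? (proj₁ (spans (there ab∈E))) a-away ,
      ∈-filter⁺ away? (proj₂ (spans (there ab∈E))) b-away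

    |E'|+|R|≡|E| : length E' + length R ≡ length E
    |E'|+|R|≡|E| = length-filter+length-filter-∁ inner? E

    no-edge-between-endpoints : ∀ {a b} → (a , b) ∈ E → Endpoint a → Endpoint b → ⊥
    no-edge-between-endpoints uu∈E (inj₁ refl) (inj₁ refl) = ℕ.<-irrefl refl (oriented (there uu∈E))
    no-edge-between-endpoints uv∈E (inj₁ refl) (inj₂ refl) = Unique.Unique[x∷xs]⇒x∉xs uv∷E! uv∈E
    no-edge-between-endpoints vu∈E (inj₂ refl) (inj₁ refl) = ℕ.<-asym v<u (oriented (there vu∈E))
    no-edge-between-endpoints vv∈E (inj₂ refl) (inj₂ refl) = ℕ.<-irrefl refl (oriented (there vv∈E))

    far : Edge n → Fin n
    far (a , b) with endpoint-or-away a
    ... | inj₁ _ = b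
    ... | inj₂ _ = a

    Joins : Edge n → Fin n → Fin n → Set
    Joins e c w = e ≡ (c , w) ⊎ e ≡ (w , c)

    R-edge : ∀ {e} → e ∈ R → ∃[ c ] (Endpoint c × Away (far e) × Joins e c (far e))
    R-edge {a , b} e∈R with ∈-filter⁻ (¬? ∘ inner?) {xs = E} e∈R
    ... | e∈E , not-inner with endpoint-or-away a | endpoint-or-away b
    ... | inj₁ a-end | inj₁ b-end = ⊥-elim (no-edge-between-endpoints e∈E a-end b-end)
    ... | inj₁ a-end | inj₂ b-away = a , a-end , b-away , inj₁ refl
    ... | inj₂ a-away | inj₁ b-end = b , b-end , a-away , inj₂ refl
    ... | inj₂ a-away | inj₂ b-away = ⊥-elim (not-inner (a-away , b-away))

    R⊆E : R ⊆ E
    R⊆E = proj₁ ∘ ∈-filter⁻ (¬? ∘ inner?) {xs = E}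

    joins⇒adjacent : ∀ {e c w} → e ∈ E → Joins e c w → Adjacent ((u , v) ∷ E) w c
    joins⇒adjacent cw∈E (inj₁ refl) = inj₂ (there cw∈E)
    joins⇒adjacent wc∈E (inj₂ refl) = inj₁ (there wc∈E)

    joins-unique : ∀ {e₁ e₂ c w} → e₁ ∈ E → e₂ ∈ E → Joins e₁ c w → Joins e₂ c w → e₁ ≡ e₂
    joins-unique _ _ (inj₁ refl) (inj₁ refl) = refl
    joins-unique _ _ (inj₂ refl) (inj₂ refl) = refl
    joins-unique e₁∈E e₂∈E (inj₁ refl) (inj₂ refl) =
      ⊥-elim (ℕ.<-asym (oriented (there e₁∈E)) (oriented (there e₂∈E)))
    joins-unique e₁∈E e₂∈E (inj₂ refl) (inj₁ refl) =
      ⊥-elim (ℕ.<-asym (oriented (there e₁∈E)) (oriented (there e₂∈E)))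

    endpoints-adjacent : ∀ {c₁ c₂} → Endpoint c₁ → Endpoint c₂ → c₁ ≢ c₂ → Adjacent ((u , v) ∷ E) c₁ c₂
    endpoints-adjacent (inj₁ refl) (inj₁ refl) c₁≢c₂ = ⊥-elim (c₁≢c₂ refl)
    endpoints-adjacent (inj₁ refl) (inj₂ refl) _ = inj₁ (here refl)
    endpoints-adjacent (inj₂ refl) (inj₁ refl) _ = inj₂ (here refl)
    endpoints-adjacent (inj₂ refl) (inj₂ refl) c₁≢c₂ = ⊥-elim (c₁≢c₂ refl)

    far-injective : ∀ {e₁ e₂} → e₁ ∈ R → e₂ ∈ R → far e₁ ≡ far e₂ → e₁ ≡ e₂
    far-injective {e₁} {e₂} e₁∈R e₂∈R far≡ with R-edge e₁∈R | R-edge e₂∈R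
    ... | c₁ , c₁-end , _ , joins₁ | c₂ , c₂-end , _ , joins₂ with c₁ Fin.≟ c₂
    ... | yes refl = joins-unique (R⊆E e₁∈R) (R⊆E e₂∈R) joins₁ (subst (Joins e₂ c₁) (sym far≡) joins₂)
    ... | no c₁≢c₂ = ⊥-elim (TriangleFree⇒¬triangle oriented triangle-free
            (joins⇒adjacent (R⊆E e₁∈R) joins₁)
            (endpoints-adjacent c₁-end c₂-end c₁≢c₂)
            (subst (λ w → Adjacent ((u , v) ∷ E) w c₂) (sym far≡) (joins⇒adjacent (R⊆E e₂∈R) joins₂)))

    far∈V' : ∀ {e} → e ∈ R → far e ∈ V'
    far∈V' e∈R with R-edge e∈R
    ... | _ , _ , far-away , joins = ∈-filter⁺ away? (joins⇒∈V (R⊆E e∈R) joins) far-away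
      where
      joins⇒∈V : ∀ {e c w} → e ∈ E → Joins e c w → w ∈ V
      joins⇒∈V cw∈E (inj₁ refl) = proj₂ (spans (there cw∈E))
      joins⇒∈V wc∈E (inj₂ refl) = proj₁ (spans (there wc∈E))

    |R|≤|V'| : length R ≤ length V'
    |R|≤|V'| = subst (_≤ length V') (List.length-map far R)
      (Unique-⊆⇒length≤ Fin._≟_
        (Unique-map⁺ far far-injective (Unique.filter⁺ (¬? ∘ inner?) E!))
        farR⊆V')
      where
      farR⊆V' : map far R ⊆ V'
      farR⊆V' w∈farR with ∈-map⁻ far w∈farR
      ... | _ , e∈R , refl = far∈V' e∈R

  -- (k + 2)² = k² + 4k + 4 absorbs the edge uv and the at most k edges at u or v.
  4[1+e+r]≤[2+k]² : ∀ k e r → 4 * e ≤ k * k → r ≤ k → 4 * suc (e + r) ≤ (2 + k) * (2 + k)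
  4[1+e+r]≤[2+k]² k e r 4e≤k² r≤k = begin
    4 * suc (e + r)       ≡⟨ expand e r ⟩
    4 * e + 4 * r + 4     ≤⟨ ℕ.+-monoˡ-≤ 4 (ℕ.+-mono-≤ 4e≤k² (ℕ.*-monoʳ-≤ 4 r≤k)) ⟩
    k * k + 4 * k + 4     ≡⟨ square k ⟩
    (2 + k) * (2 + k)     ∎
    where
    open ℕ.≤-Reasoning
    expand : ∀ e r → 4 * suc (e + r) ≡ 4 * e + 4 * r + 4
    expand = solve-∀
    square : ∀ k → k * k + 4 * k + 4 ≡ (2 + k) * (2 + k)
    square = solve-∀

  mantel-bounded : ∀ m {V E} → length V ≤ m → Unique V → Unique E → Oriented E → TriangleFree E →
    Spans V E → 4 * length E ≤ length V * length V
  mantel-bounded m {E = []} _ _ _ _ _ _ = z≤n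
  mantel-bounded m {V} {(u , v) ∷ E} |V|≤m V! E! oriented triangle-free spans = bound m |V|≤m
    where
    open WithoutEdge V u v E V! E! oriented triangle-free spans
    bound : ∀ m → length V ≤ m → 4 * length ((u , v) ∷ E) ≤ length V * length V
    bound zero |V|≤0 with ℕ.≤-trans 2+|V'|≤|V| |V|≤0
    ... | ()
    bound (suc zero) |V|≤1 with ℕ.≤-trans 2+|V'|≤|V| |V|≤1
    ... | s≤s ()
    bound (suc (suc m)) |V|≤2+m = ℕ.≤-trans
      (subst (λ k → 4 * suc k ≤ (2 + length V') * (2 + length V')) |E'|+|R|≡|E|
        (4[1+e+r]≤[2+k]² (length V') (length E') (length R) IH |R|≤|V'|))
      (ℕ.*-mono-≤ 2+|V'|≤|V| 2+|V'|≤|V|)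
      where
      IH : 4 * length E' ≤ length V' * length V'
      IH = mantel-bounded m (ℕ.≤-pred (ℕ.≤-pred (ℕ.≤-trans 2+|V'|≤|V| |V|≤2+m))) (Unique.filter⁺ away? V!) E'!
        (oriented ∘ there ∘ E'⊆E)
        (λ ba∈E' cb∈E' ca∈E' → triangle-free (there (E'⊆E ba∈E')) (there (E'⊆E cb∈E')) (there (E'⊆E ca∈E')))
        E'-spans

  mantel : ∀ {V E} → Unique V → Unique E → Oriented E → TriangleFree E → Spans V E →
    4 * length E ≤ length V * length V
  mantel {V} = mantel-bounded (length V) ℕ.≤-refl

module PrivateInversions {n : ℕ} {Q : List (Perm (suc n))} (Q-perms : All IsPerm Q)
  (minimal : MinimallyInversionComplete Q) where

  PrivateInversionOf : Perm (suc n) → Edge (suc n) → Set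
  PrivateInversionOf π (a , b) = PrivatePair Inversion Q π a b

  -- The fallback (0 , 0) is never used for π ∈ Q, which always has a private inversion.
  pick : ∀ {π} → Dec (∃[ a ] ∃[ b ] PrivatePair Inversion Q π a b) → Edge (suc n)
  pick (yes (a , b , _)) = a , b
  pick (no _) = Fin.zero , Fin.zero

  pick-private : ∀ {π} (found? : Dec (∃[ a ] ∃[ b ] PrivatePair Inversion Q π a b)) →
    π ∈ Q → PrivateInversionOf π (pick found?)
  pick-private (yes (_ , _ , private-pair)) _ = private-pair
  pick-private (no none) π∈Q = ⊥-elim (none (minimal⇒private Inversion inversion? minimal π∈Q))

  opaque
    privateInversion : Perm (suc n) → Edge (suc n)
    privateInversion π = pick (privatePair? Inversion inversion? Q π)

    privateInversion-private : ∀ {π} → π ∈ Q → PrivateInversionOf π (privateInversion π)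
    privateInversion-private {π} = pick-private (privatePair? Inversion inversion? Q π)

  E : List (Edge (suc n))
  E = map privateInversion Q

  ∈E⇒private : ∀ {a b : Fin (suc n)} → (a , b) ∈ E →
    ∃[ π ] (π ∈ Q × privateInversion π ≡ (a , b) × PrivatePair Inversion Q π a b)
  ∈E⇒private ab∈E with ∈-map⁻ privateInversion ab∈E
  ... | π , π∈Q , ab≡ = π , π∈Q , sym ab≡ ,
    subst (PrivateInversionOf π) (sym ab≡) (privateInversion-private π∈Q)

  covers⇒privateInversion : ∀ {a b : Fin (suc n)} {π} → (a , b) ∈ E → π ∈ Q → Covers π a b →
    privateInversion π ≡ (a , b)
  covers⇒privateInversion {a} {b} ab∈E π∈Q covers =
    let _ , _ , π₀↦ab , _ , _ , only-π₀ = ∈E⇒private ab∈E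
    in subst (λ σ → privateInversion σ ≡ (a , b)) (sym (All.lookup only-π₀ π∈Q covers)) π₀↦ab

  E-oriented : Oriented E
  E-oriented ab∈E = let _ , _ , _ , b<a , _ = ∈E⇒private ab∈E in b<a

  privateInversion-injective : ∀ {π₁ π₂} → π₁ ∈ Q → π₂ ∈ Q →
    privateInversion π₁ ≡ privateInversion π₂ → π₁ ≡ π₂
  privateInversion-injective {π₁} π₁∈Q π₂∈Q same =
    let _ , π₁-covers , _ = privateInversion-private π₁∈Q
        _ , _ , only-π₂ = privateInversion-private π₂∈Q
    in All.lookup only-π₂ π₁∈Q (subst (λ e → Covers π₁ (proj₁ e) (proj₂ e)) same π₁-covers)

  E-triangle-free : TriangleFree E
  E-triangle-free {a} {b} {c} ba∈E cb∈E ca∈E with ∈E⇒private ca∈E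
  ... | π , π∈Q , π↦ca , _ , (k , l , k<l , πk≡c , πl≡a) , _
    with IsPerm⇒surjective π (All.lookup Q-perms π∈Q) b
  ... | j , πj≡b with Fin.<-cmp j l
  ... | tri< j<l _ _ = ℕ.<-irrefl (cong (Fin.toℕ ∘ proj₁) (trans (sym π↦ba) π↦ca)) (E-oriented cb∈E)
    where
    π↦ba : privateInversion π ≡ (b , a)
    π↦ba = covers⇒privateInversion ba∈E π∈Q (j , l , j<l , πj≡b , πl≡a)
  ... | tri≈ _ refl _ = ℕ.<-irrefl (cong Fin.toℕ (trans (sym πl≡a) πj≡b)) (E-oriented ba∈E)
  ... | tri> _ _ l<j = ℕ.<-irrefl (cong (Fin.toℕ ∘ proj₂) (trans (sym π↦ca) π↦cb)) (E-oriented ba∈E)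
    where
    π↦cb : privateInversion π ≡ (c , b)
    π↦cb = covers⇒privateInversion cb∈E π∈Q (k , j , Fin.<-trans k<l l<j , πk≡c , πj≡b)

4*m≤n⇒m≤n/4 : ∀ {m n} → 4 * m ≤ n → m ≤ n / 4
4*m≤n⇒m≤n/4 {m} {n} 4m≤n = begin
  m          ≡⟨ m*n/n≡m m 4 ⟨
  m * 4 / 4  ≤⟨ /-monoˡ-≤ 4 (subst (_≤ n) (ℕ.*-comm 4 m) 4m≤n) ⟩
  n / 4      ∎
  where open ℕ.≤-Reasoning

minimallyInversionComplete⇒length≤ : ∀ {n} (Q : List (Perm (suc n))) → IsSubsetOfS (suc n) Q →
  MinimallyInversionComplete Q → length Q ≤ suc n * suc n / 4
minimallyInversionComplete⇒length≤ {n} Q (Q-perms , Q!) minimal = 4*m≤n⇒m≤n/4 4|Q|≤n²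
  where
  open PrivateInversions Q-perms minimal
  4|Q|≤n² : 4 * length Q ≤ suc n * suc n
  4|Q|≤n² = subst₂ (λ e v → 4 * e ≤ v * v)
    (List.length-map privateInversion Q) (List.length-tabulate {n = suc n} (λ i → i))
    (mantel (Unique.allFin⁺ (suc n)) (Unique-map⁺ privateInversion privateInversion-injective Q!)
      E-oriented E-triangle-free λ _ → ∈-allFin _ , ∈-allFin _)

module Construction (p₂ q₂ : ℕ) where

  p q N : ℕ
  p = 2 + p₂
  q = 2 + q₂
  N = p + q

  InA InB : Fin N → Set
  InA v = toℕ v < p
  InB v = p ≤ toℕ v

  left right : Fin N
  left = fromℕ< (ℕ.m≤m+n p q)
  right = fromℕ< (ℕ.m<m+n p z<s)

  toℕ-left : toℕ left ≡ suc p₂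
  toℕ-left = Fin.toℕ-fromℕ< (ℕ.m≤m+n p q)

  toℕ-right : toℕ right ≡ p
  toℕ-right = Fin.toℕ-fromℕ< (ℕ.m<m+n p z<s)

  InA⇒≢right : ∀ {v} → InA v → v ≢ right
  InA⇒≢right v<p refl = ℕ.<-irrefl toℕ-right v<p

  InB⇒≢left : ∀ {v} → InB v → v ≢ left
  InB⇒≢left p≤v refl = ℕ.<⇒≱ (ℕ.n<1+n (suc p₂)) (subst (p ≤_) toℕ-left p≤v)

  InA-InB⇒≢ : ∀ {u v} → InA u → InB v → u ≢ v
  InA-InB⇒≢ u<p p≤u refl = ℕ.<-irrefl refl (ℕ.<-≤-trans u<p p≤u)

  InA-≢left⇒< : ∀ {v} → InA v → v ≢ left → toℕ v < suc p₂
  InA-≢left⇒< {v} v<p v≢left with ℕ.m≤n⇒m<n∨m≡n (ℕ.≤-pred v<p)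
  ... | inj₁ v<1+p₂ = v<1+p₂
  ... | inj₂ v≡1+p₂ = ⊥-elim (v≢left (Fin.toℕ-injective (trans v≡1+p₂ (sym toℕ-left))))

  InB-≢right⇒> : ∀ {v} → InB v → v ≢ right → p < toℕ v
  InB-≢right⇒> {v} p≤v v≢right with ℕ.m≤n⇒m<n∨m≡n p≤v
  ... | inj₁ p<v = p<v
  ... | inj₂ p≡v = ⊥-elim (v≢right (Fin.toℕ-injective (trans (sym p≡v) (sym toℕ-right))))

  -- In one-line notation σ a b lists A ∖ {a}, then b and a in the slots left and right,
  -- then B ∖ {b}; σ a b ⟨$⟩ˡ v is the slot of v.
  σ : Fin N → Fin N → Permutation′ N
  σ a b = transpose left right ∘ₚ transpose b right ∘ₚ transpose a left

  σ⁻¹-steps : ∀ a b v {w₁ w₂ w₃} → PC.transpose left a v ≡ w₁ → PC.transpose right b w₁ ≡ w₂ →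
    PC.transpose right left w₂ ≡ w₃ → σ a b ⟨$⟩ˡ v ≡ w₃
  σ⁻¹-steps a b v step₁ step₂ step₃ =
    trans (cong (PC.transpose right left) (trans (cong (PC.transpose right b) step₁) step₂)) step₃

  slot : Fin N → Fin N → Fin N → ℕ
  slot a b v = toℕ (σ a b ⟨$⟩ˡ v)

  left≢right : left ≢ right
  left≢right left≡right =
    ℕ.<-irrefl (trans (sym toℕ-left) (trans (cong toℕ left≡right) toℕ-right)) (ℕ.n<1+n (suc p₂))

  module _ {a b} (a∈A : InA a) (b∈B : InB b) where

    private
      a≢b : a ≢ b
      a≢b = InA-InB⇒≢ a∈A b∈B

    slot-a : slot a b a ≡ p
    slot-a = trans (cong toℕ (σ⁻¹-steps a b a (transpose-ʳ left a)
      (transpose-≢ right b left≢right (≢-sym (InB⇒≢left b∈B))) (transpose-ʳ right left))) toℕ-right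

    slot-b : slot a b b ≡ suc p₂
    slot-b = trans (cong toℕ (σ⁻¹-steps a b b (transpose-≢ left a (InB⇒≢left b∈B) (≢-sym a≢b))
      (transpose-ʳ right b) (transpose-ˡ right left))) toℕ-left

    slot-A : ∀ {v} → InA v → v ≢ a → slot a b v < suc p₂
    slot-A {v} = cases (v Fin.≟ left)
      where
      cases : ∀ {v} → Dec (v ≡ left) → InA v → v ≢ a → slot a b v < suc p₂
      cases (yes refl) _ left≢a = subst (_< suc p₂) (cong toℕ (sym moved)) (InA-≢left⇒< a∈A (≢-sym left≢a))
        where
        moved : σ a b ⟨$⟩ˡ left ≡ a
        moved = σ⁻¹-steps a b left (transpose-ˡ left a) (transpose-≢ right b (InA⇒≢right a∈A) a≢b)
          (transpose-≢ right left (InA⇒≢right a∈A) (≢-sym left≢a))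
      cases {v} (no v≢left) v∈A v≢a = subst (_< suc p₂) (cong toℕ (sym fixed)) (InA-≢left⇒< v∈A v≢left)
        where
        fixed : σ a b ⟨$⟩ˡ v ≡ v
        fixed = σ⁻¹-steps a b v (transpose-≢ left a v≢left v≢a)
          (transpose-≢ right b (InA⇒≢right v∈A) (InA-InB⇒≢ v∈A b∈B))
          (transpose-≢ right left (InA⇒≢right v∈A) v≢left)

    slot-B : ∀ {v} → InB v → v ≢ b → p < slot a b v
    slot-B {v} = cases (v Fin.≟ right)
      where
      cases : ∀ {v} → Dec (v ≡ right) → InB v → v ≢ b → p < slot a b v
      cases (yes refl) _ right≢b = subst (p <_) (cong toℕ (sym moved)) (InB-≢right⇒> b∈B (≢-sym right≢b))
        where
        moved : σ a b ⟨$⟩ˡ right ≡ b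
        moved = σ⁻¹-steps a b right (transpose-≢ left a (≢-sym left≢right) (≢-sym (InA⇒≢right a∈A)))
          (transpose-ˡ right b) (transpose-≢ right left (≢-sym right≢b) (InB⇒≢left b∈B))
      cases {v} (no v≢right) v∈B v≢b = subst (p <_) (cong toℕ (sym fixed)) (InB-≢right⇒> v∈B v≢right)
        where
        fixed : σ a b ⟨$⟩ˡ v ≡ v
        fixed = σ⁻¹-steps a b v (transpose-≢ left a (InB⇒≢left v∈B) (≢-sym (InA-InB⇒≢ a∈A v∈B)))
          (transpose-≢ right b v≢right v≢b) (transpose-≢ right left v≢right (InB⇒≢left v∈B))

    slot-A≤p : ∀ {v} → InA v → slot a b v ≤ p
    slot-A≤p {v} v∈A with v Fin.≟ a
    ... | yes refl = ℕ.≤-reflexive slot-a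
    ... | no v≢a = ℕ.<⇒≤ (ℕ.<-trans (slot-A v∈A v≢a) (ℕ.n<1+n (suc p₂)))

    σ-covers⁻ : ∀ {x y} → InB x → InA y → Covers (oneLine (σ a b)) x y → x ≡ b × y ≡ a
    σ-covers⁻ {x} {y} x∈B y∈A covers with oneLine-covers⁻ (σ a b) covers | x Fin.≟ b | y Fin.≟ a
    ... | _ | yes x≡b | yes y≡a = x≡b , y≡a
    ... | x<y | no x≢b | _ =
      ⊥-elim (ℕ.<-irrefl refl (ℕ.<-≤-trans (ℕ.<-trans (slot-B x∈B x≢b) x<y) (slot-A≤p y∈A)))
    ... | x<y | yes refl | no y≢a = ⊥-elim (ℕ.<-asym (slot-A y∈A y≢a) (subst (_< slot a b y) slot-b x<y))

  data Block : Fin N → Set where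
    inA : (i : Fin p) → Block (i ↑ˡ q)
    inB : (j : Fin q) → Block (p ↑ʳ j)

  block : ∀ v → Block v
  block v with splitAt p v in eq
  ... | inj₁ i = subst Block (Fin.splitAt⁻¹-↑ˡ eq) (inA i)
  ... | inj₂ j = subst Block (Fin.splitAt⁻¹-↑ʳ eq) (inB j)

  ↑ˡ-InA : ∀ i → InA (i ↑ˡ q)
  ↑ˡ-InA i = subst (_< p) (sym (Fin.toℕ-↑ˡ i q)) (Fin.toℕ<n i)

  ↑ʳ-InB : ∀ j → InB (p ↑ʳ j)
  ↑ʳ-InB j = subst (p ≤_) (sym (Fin.toℕ-↑ʳ p j)) (ℕ.m≤m+n p (toℕ j))

  member : Fin p → Fin q → Perm N
  member i j = oneLine (σ (i ↑ˡ q) (p ↑ʳ j))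

  family : List (Perm N)
  family = cartesianProductWith member (allFin p) (allFin q)

  member∈family : ∀ i j → member i j ∈ family
  member∈family i j = ∈-cartesianProductWith⁺ member (∈-allFin i) (∈-allFin j)

  ∈family⇒member : ∀ {π} → π ∈ family → ∃[ i ] ∃[ j ] (π ≡ member i j)
  ∈family⇒member π∈ with ∈-cartesianProductWith⁻ member (allFin p) (allFin q) π∈
  ... | i , j , _ , _ , π≡ = i , j , π≡

  covered-by : ∀ i j {x y} → slot (i ↑ˡ q) (p ↑ʳ j) x < slot (i ↑ˡ q) (p ↑ʳ j) y →
    ∃[ π ] (π ∈ family × Covers π x y)
  covered-by i j x<y = member i j , member∈family i j , oneLine-covers (σ (i ↑ˡ q) (p ↑ʳ j)) x<y

  member-covers-private : ∀ i j → Covers (member i j) (p ↑ʳ j) (i ↑ˡ q)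
  member-covers-private i j = oneLine-covers (σ (i ↑ˡ q) (p ↑ʳ j))
    (subst₂ _<_ (sym (slot-b (↑ˡ-InA i) (↑ʳ-InB j))) (sym (slot-a (↑ˡ-InA i) (↑ʳ-InB j))) (ℕ.n<1+n (suc p₂)))

  member-covers⁻ : ∀ {i j i' j'} → Covers (member i' j') (p ↑ʳ j) (i ↑ˡ q) → i' ≡ i × j' ≡ j
  member-covers⁻ {i} {j} {i'} {j'} covers with σ-covers⁻ (↑ˡ-InA i') (↑ʳ-InB j') (↑ʳ-InB j) (↑ˡ-InA i) covers
  ... | b≡b' , a≡a' = sym (Fin.↑ˡ-injective q i i' a≡a') , sym (Fin.↑ʳ-injective p j j' b≡b')

  member-injective : ∀ {i i' j j'} → member i j ≡ member i' j' → i ≡ i' × j ≡ j'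
  member-injective {i} {j = j} same =
    let i'≡i , j'≡j = member-covers⁻ (subst (λ π → Covers π (p ↑ʳ j) (i ↑ˡ q)) same (member-covers-private i j))
    in sym i'≡i , sym j'≡j

  family-IsSubsetOfS : IsSubsetOfS N family
  family-IsSubsetOfS =
    All.tabulate (λ π∈ → let i , j , π≡ = ∈family⇒member π∈ in
      subst IsPerm (sym π≡) (oneLine-IsPerm (σ (i ↑ˡ q) (p ↑ʳ j)))) ,
    Unique.cartesianProductWith⁺ member member-injective (Unique.allFin⁺ p) (Unique.allFin⁺ q)

  family-length : length family ≡ p * q
  family-length = trans (length-cartesianProductWith member (allFin p) (allFin q))
    (cong₂ _*_ (List.length-tabulate {n = p} (λ i → i)) (List.length-tabulate {n = q} (λ j → j)))

  family-pairComplete : PairComplete family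
  family-pairComplete x y x≢y with block x | block y
  ... | inA i₁ | inA i₂ = covered-by i₂ Fin.zero (ℕ.<-trans
          (slot-A (↑ˡ-InA i₂) (↑ʳ-InB Fin.zero) (↑ˡ-InA i₁) x≢y)
          (subst (suc p₂ <_) (sym (slot-a (↑ˡ-InA i₂) (↑ʳ-InB Fin.zero))) (ℕ.n<1+n (suc p₂))))
  ... | inB j₁ | inB j₂ = covered-by Fin.zero j₁ (ℕ.<-trans
          (subst (_< p) (sym (slot-b (↑ˡ-InA Fin.zero) (↑ʳ-InB j₁))) (ℕ.n<1+n (suc p₂)))
          (slot-B (↑ˡ-InA Fin.zero) (↑ʳ-InB j₁) (↑ʳ-InB j₂) (≢-sym x≢y)))
  ... | inB j | inA i = member i j , member∈family i j , member-covers-private i j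
  ... | inA i | inB j = covered-by i' j' (ℕ.<-trans
          (slot-A (↑ˡ-InA i') (↑ʳ-InB j') (↑ˡ-InA i) (i'≢i ∘ sym ∘ Fin.↑ˡ-injective q i i'))
          (ℕ.<-trans (ℕ.n<1+n (suc p₂))
            (slot-B (↑ˡ-InA i') (↑ʳ-InB j') (↑ʳ-InB j) (j'≢j ∘ sym ∘ Fin.↑ʳ-injective p j j'))))
    where
    i' : Fin p
    i' = Fin.punchIn i Fin.zero
    j' : Fin q
    j' = Fin.punchIn j Fin.zero
    i'≢i : i' ≢ i
    i'≢i = Fin.punchInᵢ≢i i Fin.zero
    j'≢j : j' ≢ j
    j'≢j = Fin.punchInᵢ≢i j Fin.zero

  family-private : ∀ (R : Fin N → Fin N → Set) → (∀ i j → R (p ↑ʳ j) (i ↑ˡ q)) →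
    ∀ {π} → π ∈ family → ∃[ x ] ∃[ y ] PrivatePair R family π x y
  family-private R R-ba π∈ with ∈family⇒member π∈
  ... | i , j , refl = p ↑ʳ j , i ↑ˡ q , R-ba i j , member-covers-private i j ,
    All.tabulate λ π'∈ covers → let i' , j' , π'≡ = ∈family⇒member π'∈ in
      trans π'≡ (uncurry (cong₂ member) (member-covers⁻ (subst (λ π → Covers π _ _) π'≡ covers)))

  family-minimallyInversionComplete : MinimallyInversionComplete family
  family-minimallyInversionComplete =
    private⇒minimal Inversion (λ a b b<a → family-pairComplete a b (≢-sym (Fin.<⇒≢ b<a)))
      (family-private Inversion λ i j → ℕ.<-≤-trans (↑ˡ-InA i) (↑ʳ-InB j))

  family-minimallyPairComplete : MinimallyPairComplete family
  family-minimallyPairComplete =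
    private⇒minimal _≢_ family-pairComplete (family-private _≢_ λ i j → ≢-sym (InA-InB⇒≢ (↑ˡ-InA i) (↑ʳ-InB j)))

balanced-split : ∀ n → ∃[ p ] ∃[ q ] (n ≡ p + q × (q ≡ p ⊎ q ≡ suc p))
balanced-split zero = 0 , 0 , refl , inj₁ refl
balanced-split (suc n) with balanced-split n
... | p , _ , refl , inj₁ refl = p , suc p , sym (ℕ.+-suc p p) , inj₂ refl
... | p , _ , refl , inj₂ refl = suc p , suc p , refl , inj₁ refl

[p+q]²/4≡p*q : ∀ p q → (q ≡ p ⊎ q ≡ suc p) → (p + q) * (p + q) / 4 ≡ p * q
[p+q]²/4≡p*q p _ (inj₁ refl) = begin
  (p + p) * (p + p) / 4  ≡⟨ cong (_/ 4) (even-square p) ⟩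
  p * p * 4 / 4          ≡⟨ m*n/n≡m (p * p) 4 ⟩
  p * p                  ∎
  where
  open ≡-Reasoning
  even-square : ∀ p → (p + p) * (p + p) ≡ p * p * 4
  even-square = solve-∀
[p+q]²/4≡p*q p _ (inj₂ refl) = begin
  (p + suc p) * (p + suc p) / 4  ≡⟨ cong (_/ 4) (odd-square p) ⟩
  (p * suc p * 4 + 1) / 4        ≡⟨ +-distrib-/ (p * suc p * 4) 1 remainders<4 ⟩
  p * suc p * 4 / 4 + 1 / 4      ≡⟨ cong (_+ 0) (m*n/n≡m (p * suc p) 4) ⟩
  p * suc p + 0                  ≡⟨ ℕ.+-identityʳ _ ⟩
  p * suc p                      ∎
  where
  open ≡-Reasoning
  odd-square : ∀ p → (p + suc p) * (p + suc p) ≡ p * suc p * 4 + 1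
  odd-square = solve-∀
  remainders<4 : p * suc p * 4 % 4 + 1 % 4 < 4
  remainders<4 = subst (λ r → r + 1 % 4 < 4) (sym (m*n%n≡0 (p * suc p) 4)) (s≤s (s≤s z≤n))

ExtremalFamily : ℕ → Set
ExtremalFamily n = ∃[ Q ] (IsSubsetOfS n Q × MinimallyInversionComplete Q × MinimallyPairComplete Q ×
  length Q ≡ n * n / 4)

extremalFamily : ∀ n → 4 ≤ n → ExtremalFamily n
extremalFamily _ (s≤s (s≤s (s≤s (s≤s {n = k} _)))) with balanced-split k
... | p₂ , q₂ , refl , balanced = subst ExtremalFamily (sym (split p₂ q₂))
  (family , family-IsSubsetOfS , family-minimallyInversionComplete , family-minimallyPairComplete ,
   trans family-length (sym ([p+q]²/4≡p*q p q (Sum.map (cong (2 +_)) (cong (2 +_)) balanced))))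
  where
  open Construction p₂ q₂
  split : ∀ p₂ q₂ → 4 + (p₂ + q₂) ≡ (2 + p₂) + (2 + q₂)
  split = solve-∀

corollary9 : ∀ (n : ℕ) → 4 ≤ n →
    IsGammaI n ((n * n) / 4) ×
    (∀ (g : ℕ) → IsGammaP n g → (n * n) / 4 ≤ g)
corollary9 zero ()
corollary9 (suc n) 4≤n with extremalFamily (suc n) 4≤n
... | Q , Q-subset , Q-minimallyInversionComplete , Q-minimallyPairComplete , |Q|≡n²/4 =
  ((Q , Q-subset , Q-minimallyInversionComplete , |Q|≡n²/4) , minimallyInversionComplete⇒length≤) ,
  λ g (_ , maximal) → subst (_≤ g) |Q|≡n²/4 (maximal Q Q-subset Q-minimallyPairComplete)
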